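{- Let $a$ be a transformation of a finite set and $S=\langle a\rangle$ the monogenic semigroup it generates, with index $m$ and period $r$, i.e. $m,r$ are the least positive integers with $a^{m}=a^{m+r}$. Then $\mathrm{Gr}(S)=\mathrm{Gr}(\{a^{m}\})$.
   Context: Transformations act on the right. For a set $M$ of transformations of a finite set $V$, $\mathrm{Gr}(M)$ is the graph on $V$ in which distinct $v,w$ are adjacent iff there is no $f\in M$ with $vf=wf$. -}

module Defs where

open import Data.Nat using (ℕ; zero; suc)
open import Data.Fin using (Fin)
open import Data.Product using (Σ; _×_)
open import Relation.Binary.PropositionalEquality using (_≡_)
open import Relation.Nullary using (¬_)
open import Level using (Level; suc; zero)

Transformation : ℕ → Set
Transformation n = Fin n → Fin n

_≐_ : ∀ {n} → Transformation n → Transformation n → Set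
f ≐ g = ∀ v → f v ≡ g v

-- Powers: v a^k = a applied k times to v (right action; since all
-- factors are a, the order of composition is irrelevant).
_^_ : ∀ {n} → Transformation n → ℕ → Transformation n
(a ^ zero) v = v
(a ^ ℕ.suc k) v = a ((a ^ k) v)

TransSet : ℕ → Set₁
TransSet n = Transformation n → Set

⟨_⟩ : ∀ {n} → Transformation n → TransSet n
⟨ a ⟩ f = Σ ℕ λ k → f ≐ (a ^ ℕ.suc k)

｛_｝ : ∀ {n} → Transformation n → TransSet n
｛ b ｝ f = f ≐ b

-- Adjacency in Gr(M): v, w distinct and no f ∈ M with vf = wf.
Adj : ∀ {n} → TransSet n → Fin n → Fin n → Set
Adj M v w = ¬ (v ≡ w) × (∀ f → M f → ¬ (f v ≡ f w))

IsIndexPeriod : ∀ {n} → Transformation n → ℕ → ℕ → Set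
IsIndexPeriod a m r =
  (1 Data.Nat.≤ m) × (1 Data.Nat.≤ r) × ((a ^ m) ≐ (a ^ (m Data.Nat.+ r))) ×
  (∀ m' r' → 1 Data.Nat.≤ m' → 1 Data.Nat.≤ r' → (a ^ m') ≐ (a ^ (m' Data.Nat.+ r')) →
     (m Data.Nat.≤ m') × (r Data.Nat.≤ r'))

module Submission where

-- Two points v, w are non-adjacent in Gr(M) exactly when some f ∈ M
-- collapses them (v f = w f).  So it suffices to show that ⟨a⟩ and {a^m}
-- collapse the same pairs:
--   * a^m ∈ ⟨a⟩ because m ≥ 1, so every collision of {a^m} is one of ⟨a⟩;
--   * if a^k collapses v, w then so does a^m.  Indeed collisions persist
--     under further powers (a^k v = a^k w ⇒ a^(j+k) v = a^(j+k) w), and a^m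
--     is periodic (a^m = a^(q·r + m) for all q); choosing q = k makes the
--     exponent k·r + m ≥ k, so a^m v = a^(k·r+m) v = a^(k·r+m) w = a^m w.  Only a^m = a^(m+r) with m, r ≥ 1 is used.

open import Defs
open import Data.Nat using (ℕ; zero; suc; _+_; _*_; s≤s)
open import Data.Nat.Properties using (+-comm; +-assoc)
open import Data.Nat.Tactic.RingSolver using (solve)
open import Data.List using (_∷_; [])
open import Data.Fin using (Fin)
open import Data.Product using (Σ; _×_; _,_)
open import Relation.Binary.PropositionalEquality
  using (_≡_; refl; sym; trans; cong; module ≡-Reasoning)

module _ {n : ℕ} (a : Transformation n) where

  ^-+ : ∀ x y v → (a ^ (x + y)) v ≡ (a ^ x) ((a ^ y) v)
  ^-+ zero    y v = refl
  ^-+ (suc x) y v = cong a (^-+ x y v)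

  ^-cong : ∀ {x y} → x ≡ y → (a ^ x) ≐ (a ^ y)
  ^-cong refl v = refl

  collision-persists : ∀ {v w} k j → (a ^ k) v ≡ (a ^ k) w →
                       (a ^ (j + k)) v ≡ (a ^ (j + k)) w
  collision-persists {v} {w} k j e = begin
    (a ^ (j + k)) v      ≡⟨ ^-+ j k v ⟩
    (a ^ j) ((a ^ k) v)  ≡⟨ cong (a ^ j) e ⟩
    (a ^ j) ((a ^ k) w)  ≡⟨ ^-+ j k w ⟨
    (a ^ (j + k)) w      ∎
    where open ≡-Reasoning

  periodic : ∀ m r → (a ^ m) ≐ (a ^ (m + r)) → ∀ q → (a ^ (q * r + m)) ≐ (a ^ m)
  periodic m r h zero    v = refl
  periodic m r h (suc q) v = begin
    (a ^ (r + q * r + m)) v      ≡⟨ ^-cong reassociate v ⟩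
    (a ^ (r + (q * r + m))) v    ≡⟨ ^-+ r (q * r + m) v ⟩
    (a ^ r) ((a ^ (q * r + m)) v) ≡⟨ cong (a ^ r) (periodic m r h q v) ⟩
    (a ^ r) ((a ^ m) v)          ≡⟨ ^-+ r m v ⟨
    (a ^ (r + m)) v              ≡⟨ ^-cong (+-comm r m) v ⟩
    (a ^ (m + r)) v              ≡⟨ h v ⟨
    (a ^ m) v                    ∎
    where
    open ≡-Reasoning
    reassociate : r + q * r + m ≡ r + (q * r + m)
    reassociate = +-assoc r (q * r) m

  collision-stabilises : ∀ m r → (a ^ m) ≐ (a ^ (m + suc r)) →
                         ∀ {v w} k → (a ^ k) v ≡ (a ^ k) w → (a ^ m) v ≡ (a ^ m) w
  collision-stabilises m r h {v} {w} k e = begin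
    (a ^ m) v                  ≡⟨ periodic m (suc r) h k v ⟨
    (a ^ (k * suc r + m)) v    ≡⟨ ^-cong exponent v ⟩
    (a ^ (k * r + m + k)) v    ≡⟨ collision-persists k (k * r + m) e ⟩
    (a ^ (k * r + m + k)) w    ≡⟨ ^-cong exponent w ⟨
    (a ^ (k * suc r + m)) w    ≡⟨ periodic m (suc r) h k w ⟩
    (a ^ m) w                  ∎
    where
    open ≡-Reasoning
    exponent : k * suc r + m ≡ k * r + m + k
    exponent = solve (k ∷ r ∷ m ∷ [])

adj-transfer : ∀ {n} {M N : TransSet n} {v w : Fin n} →
               (∀ f → N f → f v ≡ f w → Σ (Transformation n) λ g → M g × g v ≡ g w) →
               Adj M v w → Adj N v w
adj-transfer reflect (v≢w , no-collision) =
  v≢w , λ f f∈N fv≡fw → let (g , g∈M , gv≡gw) = reflect f f∈N fv≡fw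
                         in no-collision g g∈M gv≡gw

mainTheorem15 : (n : ℕ) (a : Transformation n) (m r : ℕ) → IsIndexPeriod a m r →
    (v w : Fin n) → (Adj ⟨ a ⟩ v w → Adj ｛ a ^ m ｝ v w) × (Adj ｛ a ^ m ｝ v w → Adj ⟨ a ⟩ v w)
mainTheorem15 n a (suc m) (suc r) (s≤s _ , s≤s _ , a^m≐a^[m+r] , _) v w =
  adj-transfer am-collision-in-⟨a⟩ , adj-transfer collision-reaches-am
  where
  am-collision-in-⟨a⟩ : ∀ f → ｛ a ^ suc m ｝ f → f v ≡ f w →
                        Σ (Transformation n) λ g → ⟨ a ⟩ g × g v ≡ g w
  am-collision-in-⟨a⟩ f f≐a^m e = f , (m , f≐a^m) , e

  collision-reaches-am : ∀ f → ⟨ a ⟩ f → f v ≡ f w →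
                         Σ (Transformation n) λ g → ｛ a ^ suc m ｝ g × g v ≡ g w
  collision-reaches-am f (k , f≐a^k) e =
    a ^ suc m , (λ _ → refl) ,
    collision-stabilises a (suc m) r a^m≐a^[m+r] (suc k)
      (trans (sym (f≐a^k v)) (trans e (f≐a^k w)))
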